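{- For any zero-set $\mathcal{Z}$, $\mu_{\mathrm{en}}(\mathcal{Z})=\sup\{\tau_{\mathrm{en}}(\mathcal{Z},\vec r,\vec c):(\vec r,\vec c)\in\widetilde{\mathcal{A}}_{\mathrm{en}}\}$, where $\widetilde{\mathcal{A}}_{\mathrm{en}}$ is the set of finitely supported pairs of enhancements $(\vec r,\vec c)$ that span for $\mathcal{Z}$ and whose associated Young diagrams satisfy $\mathcal{R}\subseteq\mathcal{Z}$ and $\mathcal{C}\subseteq\mathcal{Z}$.
   Context: $\mathbb{Z}_+=\{0,1,2,\dots\}$, $\mathbb{N}=\{1,2,\dots\}$. For $a,b\in\mathbb{N}$, $R_{a,b}=([0,a-1]\times[0,b-1])\cap\mathbb{Z}_+^2$; a zero-set is a union of $R_{a,b}$ over a finite $\mathcal{I}\subseteq\mathbb{N}^2$. For $x\in\mathbb{Z}_+^2$ and $A\subseteq\mathbb{Z}_+^2$, $\mathtt{row}(x,A)$, $\mathtt{col}(x,A)$ are the numbers of points of $A$ on the horizontal and vertical lines through $x$. Enhancements $\vec r=(r_0,r_1,\dots)$, $\vec c=(c_0,c_1,\dots)$ are weakly decreasing sequences of nonnegative integers, with associated Young diagrams $\mathcal{R}=\{(u,v)\in\mathbb{Z}_+^2:u<r_v\}$ and $\mathcal{C}=\{(u,v)\in\mathbb{Z}_+^2:v<c_u\}$. $\mathcal{T}_{\mathrm{en}}(A)=A\cup\{(i,j):(\mathtt{row}((i,j),A)+r_j,\mathtt{col}((i,j),A)+c_i)\notin\mathcal{Z}\}$; $(\vec r,\vec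 c)$ spans for $\mathcal{Z}$ if $\bigcup_t\mathcal{T}_{\mathrm{en}}^t(\emptyset)=\mathbb{Z}_+^2$; $\tau_{\mathrm{en}}(\mathcal{Z},\vec r,\vec c)=\inf\{t\in\mathbb{N}:\mathcal{T}_{\mathrm{en}}^t(\emptyset)=\mathbb{Z}_+^2\}$; $\mu_{\mathrm{en}}(\mathcal{Z})$ is the maximum of $\tau_{\mathrm{en}}$ over all spanning pairs with finite support. -}

module Defs where

open import Data.Nat using (ℕ; zero; suc; _+_; _≤_; _<_)
open import Data.Product using (Σ; ∃; ∃-syntax; _×_; _,_; proj₁; proj₂)
open import Data.Sum using (_⊎_)
open import Data.Empty using (⊥)
open import Data.List using (List; length)
open import Data.List.Relation.Unary.Any using (Any)
open import Data.List.Membership.Propositional using (_∈_)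
open import Data.List.Relation.Unary.Unique.Propositional using (Unique)
open import Relation.Nullary using (¬_)
open import Relation.Binary.PropositionalEquality using (_≡_)
open import Function.Bundles using (_⇔_)

-- A subset of ℤ₊² as a predicate:  A i j  means  (i , j) ∈ A.
Grid : Set₁
Grid = ℕ → ℕ → Set

-- The zero-set  Z = ⋃_{(a,b) ∈ I} R_{a,b}, where R_{a,b} = [0,a-1]×[0,b-1],
-- for a finite index list I.
InZ : List (ℕ × ℕ) → ℕ → ℕ → Set
InZ I u v = Any (λ p → u < proj₁ p × v < proj₂ p) I

-- The horizontal line through (i , j) (i.e. y = j) contains exactly n points of A.
-- (If it contains infinitely many, no n satisfies this.)
RowCount : Grid → ℕ → ℕ → Set
RowCount A j n = Σ (List ℕ) λ xs → Unique xs × length xs ≡ n × (∀ i → A i j ⇔ i ∈ xs)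

ColCount : Grid → ℕ → ℕ → Set
ColCount A i m = Σ (List ℕ) λ ys → Unique ys × length ys ≡ m × (∀ j → A i j ⇔ j ∈ ys)

-- (row((i,j),A) + r_j , col((i,j),A) + c_i) ∈ Z   (an infinite count is never in the finite Z)
CountInZ : List (ℕ × ℕ) → (ℕ → ℕ) → (ℕ → ℕ) → Grid → ℕ → ℕ → Set
CountInZ I r c A i j =
  ∃[ n ] ∃[ m ] (RowCount A j n × ColCount A i m × InZ I (n + r j) (m + c i))

Ten : List (ℕ × ℕ) → (ℕ → ℕ) → (ℕ → ℕ) → Grid → Grid
Ten I r c A i j = A i j ⊎ ¬ CountInZ I r c A i j

TenIter : List (ℕ × ℕ) → (ℕ → ℕ) → (ℕ → ℕ) → ℕ → Grid
TenIter I r c zero    = λ _ _ → ⊥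
TenIter I r c (suc t) = Ten I r c (TenIter I r c t)

Enhancement : (ℕ → ℕ) → Set
Enhancement r = ∀ n → r (suc n) ≤ r n

FinSupp : (ℕ → ℕ) → Set
FinSupp r = ∃[ N ] (∀ n → N ≤ n → r n ≡ 0)

Spans : List (ℕ × ℕ) → (ℕ → ℕ) → (ℕ → ℕ) → Set
Spans I r c = ∀ i j → ∃[ t ] TenIter I r c t i j

TauIs : List (ℕ × ℕ) → (ℕ → ℕ) → (ℕ → ℕ) → ℕ → Set
TauIs I r c t = (∀ i j → TenIter I r c t i j)
              × (∀ s → (∀ i j → TenIter I r c s i j) → t ≤ s)

Admissible : List (ℕ × ℕ) → (ℕ → ℕ) → (ℕ → ℕ) → Set
Admissible I r c = Enhancement r × Enhancement c × FinSupp r × FinSupp c × Spans I r c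

YoungR⊆Z : List (ℕ × ℕ) → (ℕ → ℕ) → Set
YoungR⊆Z I r = ∀ u v → u < r v → InZ I u v

YoungC⊆Z : List (ℕ × ℕ) → (ℕ → ℕ) → Set
YoungC⊆Z I c = ∀ u v → v < c u → InZ I u v

AdmissibleTilde : List (ℕ × ℕ) → (ℕ → ℕ) → (ℕ → ℕ) → Set
AdmissibleTilde I r c = Admissible I r c × YoungR⊆Z I r × YoungC⊆Z I c

IsMuEn : List (ℕ × ℕ) → ℕ → Set
IsMuEn I m = (∃[ r ] ∃[ c ] (Admissible I r c × TauIs I r c m))
           × (∀ r c → Admissible I r c → ∃[ t ] (TauIs I r c t × t ≤ m))

-- m = sup { τ_en(Z,r,c) : (r,c) ∈ Ã_en }  (supremum in ℕ ∪ {∞}, here with value m):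
-- m is an upper bound (all τ finite and ≤ m) and below every upper bound.
IsSupTilde : List (ℕ × ℕ) → ℕ → Set
IsSupTilde I m = (∀ r c → AdmissibleTilde I r c → ∃[ t ] (TauIs I r c t × t ≤ m))
               × (∀ b → (∀ r c → AdmissibleTilde I r c → ∃[ t ] (TauIs I r c t × t ≤ b)) → m ≤ b)

module Submission where

-- Those pairs are among the pairs defining μ_en(Z), so μ_en(Z) bounds their times.  For the
-- converse take (r, c) with τ_en(Z, r, c) = μ_en(Z) and cap it by Z:
-- ρ_j = min(r_j, width of row j of Z), γ_i = min(c_i, height of column i of Z).  T_en is
-- monotone in the enhancements, so T_en(ρ,γ)^t ⊆ T_en(r,c)^t and τ_en(r,c) ≤ τ_en(ρ,γ) once
-- (ρ, γ) spans.  That it spans is the heart of the proof: the (ρ,γ)-iterates form an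
-- increasing chain of "regular" sets, each determined by a finite box, so they stabilise at
-- some S; by induction on i + j every point outside S is blocked for (r, c) as well (capping
-- only happens where Z has no room), so S is closed under T_en(r,c) and contains its iterates.

open import Defs
open import Data.Nat using (ℕ; zero; suc; _+_; _≤_; _<_; _⊓_; _⊔_; z≤n; s≤s; _≤′_; ≤′-refl; ≤′-step; _<?_; _≟_)
open import Data.Nat.Properties
open import Data.Product using (∃-syntax; _×_; _,_; proj₁; proj₂; swap)
open import Data.Sum using (_⊎_; inj₁; inj₂)
open import Data.Empty using (⊥; ⊥-elim)
open import Data.Unit using (⊤; tt)
open import Data.List using (List; []; _∷_; length; upTo; map)
open import Data.List.Properties using (length-upTo)
open import Data.List.Relation.Unary.All using (All)
open import Data.List.Relation.Unary.Any using (any?)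
import Data.List.Relation.Unary.Any as Any
open import Data.List.Relation.Unary.Any.Properties using (map⁺; map⁻)
open import Data.List.Membership.Propositional using (_∈_)
open import Data.List.Membership.Propositional.Properties using (∈-upTo⁺; ∈-upTo⁻)
open import Data.List.Membership.Propositional.Properties.WithK using (unique∧set⇒bag)
open import Data.List.Relation.Unary.Unique.Propositional using (Unique)
open import Data.List.Relation.Unary.Unique.Propositional.Properties using (upTo⁺)
open import Data.List.Relation.Binary.BagAndSetEquality using (∼bag⇒↭)
open import Data.List.Relation.Binary.Permutation.Propositional.Properties using (↭-length)
open import Data.List.Extrema ≤-totalOrder using (max; v≤max⁺)
open import Relation.Nullary using (¬_; Dec; yes; no)
open import Relation.Nullary.Decidable using (_⊎-dec_; _×-dec_; ¬?) renaming (map to map-dec)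
open import Relation.Unary using (Decidable)
open import Relation.Binary.PropositionalEquality using (_≡_; refl; sym; cong; subst; subst₂)
open import Function using (_∘_; id)
open import Function.Bundles using (_⇔_; mk⇔; Equivalence)
open import Function.Properties.Equivalence using () renaming (sym to ⇔-sym; trans to ⇔-trans)
open Equivalence using (to; from)

Counts : (ℕ → Set) → ℕ → Set
Counts P n = ∃[ xs ] Unique xs × length xs ≡ n × (∀ i → P i ⇔ i ∈ xs)

-- The count is well defined: duplicate-free lists with the same members are permutations.
counts-unique : ∀ {P n n′} → Counts P n → Counts P n′ → n ≡ n′
counts-unique (xs , xs! , refl , P∼xs) (ys , ys! , refl , P∼ys) =
  ↭-length (∼bag⇒↭ (unique∧set⇒bag xs! ys! λ {z} → ⇔-trans (⇔-sym (P∼xs z)) (P∼ys z)))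

IsSegment : (ℕ → Set) → ℕ → Set
IsSegment P n = ∀ i → P i ⇔ i < n

DownClosed : (ℕ → Set) → Set
DownClosed P = ∀ {a b} → b ≤ a → P a → P b

segment⇒counts : ∀ {P n} → IsSegment P n → Counts P n
segment⇒counts {n = n} seg =
  upTo n , upTo⁺ n , length-upTo n , λ i → ⇔-trans (seg i) (mk⇔ ∈-upTo⁺ ∈-upTo⁻)

segment-unique : ∀ {P n n′} → IsSegment P n → IsSegment P n′ → n ≡ n′
segment-unique seg seg′ = counts-unique (segment⇒counts seg) (segment⇒counts seg′)

segment-below : ∀ {P} → Decidable P → DownClosed P → ∀ n → ¬ P n → ∃[ q ] q ≤ n × IsSegment P q
segment-below P? down zero ¬P0 = 0 , z≤n , λ i → mk⇔ (λ Pi → ⊥-elim (¬P0 (down z≤n Pi))) λ ()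
segment-below P? down (suc n) ¬P[1+n] with P? n
... | no ¬Pn = let q , q≤n , seg = segment-below P? down n ¬Pn in q , m≤n⇒m≤1+n q≤n , seg
... | yes Pn = suc n , ≤-refl , λ i →
  mk⇔ (λ Pi → ≰⇒> λ 1+n≤i → ¬P[1+n] (down 1+n≤i Pi)) (λ i<1+n → down (≤-pred i<1+n) Pn)

-- For decidable down-closed predicates a finite count is the length of an initial segment:
-- P fails beyond the largest counted point, and the segment found there has the same count.
counts⇒segment : ∀ {P n} → Decidable P → DownClosed P → Counts P n → IsSegment P n
counts⇒segment {P} P? down count@(xs , _ , _ , P∼xs) =
  let _ , _ , seg = segment-below P? down (suc (max 0 xs)) beyond
  in subst (IsSegment P) (counts-unique (segment⇒counts seg) count) seg
  where
  beyond : ¬ P (suc (max 0 xs))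
  beyond P[1+max] = n≮n _ (v≤max⁺ 0 xs (inj₂ (Any.map ≤-reflexive (to (P∼xs _) P[1+max]))))

sub-segment : ∀ {P Q n} → Decidable Q → DownClosed Q → (∀ i → Q i → P i) → IsSegment P n →
              ∃[ n′ ] n′ ≤ n × IsSegment Q n′
sub-segment Q? down Q⊆P segP = segment-below Q? down _ λ Qn → n≮n _ (to (segP _) (Q⊆P _ Qn))

cofinite⇒¬segment : ∀ {P} M → (∀ i → M ≤ i → P i) → ∀ {n} → ¬ IsSegment P n
cofinite⇒¬segment M from-M {n} seg =
  n≮n n (≤-<-trans (m≤n⊔m M n) (to (seg (M ⊔ n)) (from-M _ (m≤m⊔n M n))))

inZ? : ∀ I u v → Dec (InZ I u v)
inZ? I u v = any? (λ (a , b) → (u <? a) ×-dec (v <? b)) I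

inZ-down : ∀ I {u v u′ v′} → u′ ≤ u → v′ ≤ v → InZ I u v → InZ I u′ v′
inZ-down I u′≤u v′≤v = Any.map λ (u<a , v<b) → ≤-<-trans u′≤u u<a , ≤-<-trans v′≤v v<b

-- Z reflected in the diagonal; it lets column statements be read off from row statements.
transpose : List (ℕ × ℕ) → List (ℕ × ℕ)
transpose = map swap

inZ-transpose⁺ : ∀ I {u v} → InZ I u v → InZ (transpose I) v u
inZ-transpose⁺ I = map⁺ ∘ Any.map swap

inZ-transpose⁻ : ∀ I {u v} → InZ (transpose I) v u → InZ I u v
inZ-transpose⁻ I = Any.map swap ∘ map⁻

-- width I j is the length of row j of Z, i.e. max { a : (a , b) ∈ I, j < b }.
width : List (ℕ × ℕ) → ℕ → ℕ
width [] j = 0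
width ((a , b) ∷ I) j with j <? b
... | yes _ = a ⊔ width I j
... | no _ = width I j

height : List (ℕ × ℕ) → ℕ → ℕ
height I = width (transpose I)

width-young : ∀ I u v → u < width I v → InZ I u v
width-young ((a , b) ∷ I) u v u<w with v <? b
... | no _ = Any.there (width-young I u v u<w)
... | yes v<b with ⊔-sel a (width I v)
...   | inj₁ w≡a = Any.here (subst (u <_) w≡a u<w , v<b)
...   | inj₂ w≡w′ = Any.there (width-young I u v (subst (u <_) w≡w′ u<w))

width-bound : ∀ I j {x y} → width I j ≤ x → InZ I x y → y < j
width-bound ((a , b) ∷ I) j w≤x z with j <? b
width-bound ((a , b) ∷ I) j w≤x (Any.here (x<a , _)) | yes _ =
  ⊥-elim (<⇒≱ x<a (≤-trans (m≤m⊔n a _) w≤x))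
width-bound ((a , b) ∷ I) j w≤x (Any.there z) | yes _ = width-bound I j (≤-trans (m≤n⊔m a _) w≤x) z
width-bound ((a , b) ∷ I) j w≤x (Any.here (_ , y<b)) | no ¬j<b = <-≤-trans y<b (≮⇒≥ ¬j<b)
width-bound ((a , b) ∷ I) j w≤x (Any.there z) | no _ = width-bound I j w≤x z

-- Z is a down-set, so its row widths form an enhancement.
width-antitone : ∀ I → Enhancement (width I)
width-antitone [] j = z≤n
width-antitone ((a , b) ∷ I) j with suc j <? b | j <? b
... | yes _ | yes _ = ⊔-monoʳ-≤ a (width-antitone I j)
... | yes 1+j<b | no ¬j<b = ⊥-elim (¬j<b (<-trans (n<1+n j) 1+j<b))
... | no _ | yes _ = ≤-trans (width-antitone I j) (m≤n⊔m a _)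
... | no _ | no _ = width-antitone I j

height-young : ∀ I u v → v < height I u → InZ I u v
height-young I u v v<h = inZ-transpose⁻ I (width-young (transpose I) v u v<h)

height-bound : ∀ I i {x y} → height I i ≤ y → InZ I x y → x < i
height-bound I i h≤y z = width-bound (transpose I) i h≤y (inZ-transpose⁺ I z)

height-antitone : ∀ I → Enhancement (height I)
height-antitone I = width-antitone (transpose I)

antitone : ∀ {r} → Enhancement r → ∀ {a b} → b ≤ a → r a ≤ r b
antitone {r} er {b = b} b≤a = go (≤⇒≤′ b≤a)
  where
  go : ∀ {a} → b ≤′ a → r a ≤ r b
  go ≤′-refl = ≤-refl
  go (≤′-step b≤′a) = ≤-trans (er _) (go b≤′a)

record EnhancementBelow (N : ℕ) (r : ℕ → ℕ) : Set where
  field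
    decreasing : Enhancement r
    vanishes : r N ≡ 0
open EnhancementBelow

_⊓ˢ_ : (ℕ → ℕ) → (ℕ → ℕ) → ℕ → ℕ
(r ⊓ˢ w) j = r j ⊓ w j

⊓ˢ-below : ∀ {N r w} → EnhancementBelow N r → Enhancement w → EnhancementBelow N (r ⊓ˢ w)
⊓ˢ-below {N} {w = w} r↓ ew = record
  { decreasing = λ n → ⊓-mono-≤ (decreasing r↓ n) (ew n)
  ; vanishes = cong (_⊓ w N) (vanishes r↓) }

⊓ˢ-finSupp : ∀ {r} w → FinSupp r → FinSupp (r ⊓ˢ w)
⊓ˢ-finSupp w (N , r0) = N , λ n N≤n → cong (_⊓ w n) (r0 n N≤n)

record Truncation (I : List (ℕ × ℕ)) (r c ρ γ : ℕ → ℕ) : Set where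
  field
    row≤ : ∀ j → ρ j ≤ r j
    col≤ : ∀ i → γ i ≤ c i
    row-cut : ∀ {j} → ρ j < r j → ∀ {x y} → ρ j ≤ x → InZ I x y → y < j
    col-cut : ∀ {i} → γ i < c i → ∀ {x y} → γ i ≤ y → InZ I x y → x < i
open Truncation

⊓-strict : ∀ p q → p ⊓ q < p → p ⊓ q ≡ q
⊓-strict p q p⊓q<p with ⊓-sel p q
... | inj₁ p⊓q≡p = ⊥-elim (<-irrefl p⊓q≡p p⊓q<p)
... | inj₂ p⊓q≡q = p⊓q≡q

width-truncation : ∀ I r c → Truncation I r c (r ⊓ˢ width I) (c ⊓ˢ height I)
width-truncation I r c = record
  { row≤ = λ j → m⊓n≤m (r j) (width I j)
  ; col≤ = λ i → m⊓n≤m (c i) (height I i)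
  ; row-cut = λ {j} ρ<r ρ≤x → width-bound I j (subst (_≤ _) (⊓-strict _ _ ρ<r) ρ≤x)
  ; col-cut = λ {i} γ<c γ≤y → height-bound I i (subst (_≤ _) (⊓-strict _ _ γ<c) γ≤y) }

width-truncation-youngR : ∀ I r → YoungR⊆Z I (r ⊓ˢ width I)
width-truncation-youngR I r u v u<ρ = width-young I u v (<-≤-trans u<ρ (m⊓n≤n _ _))

width-truncation-youngC : ∀ I c → YoungC⊆Z I (c ⊓ˢ height I)
width-truncation-youngC I c u v v<γ = height-young I u v (<-≤-trans v<γ (m⊓n≤n _ _))

_⊆²_ : Grid → Grid → Set
A ⊆² B = ∀ i j → A i j → B i j

-- All iterates of T_en are regular, which makes their line counts
-- computable and lets a finite box determine them.
record Regular (M N : ℕ) (A : Grid) : Set where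
  field
    dec : ∀ i j → Dec (A i j)
    row-down : ∀ j → DownClosed (λ i → A i j)
    col-down : ∀ i → DownClosed (A i)
    cols-stable : ∀ {i} j → M ≤ i → A M j → A i j
    rows-stable : ∀ i {j} → N ≤ j → A i N → A i j

-- The segment form of CountInZ: row j of A is [0, n), column i is [0, k) and
-- (n + r_j, k + c_i) ∈ Z, so the point (i, j) is not added by T_en.
Blocked : List (ℕ × ℕ) → (ℕ → ℕ) → (ℕ → ℕ) → Grid → ℕ → ℕ → Set
Blocked I r c A i j =
  ∃[ n ] ∃[ k ] IsSegment (λ x → A x j) n × IsSegment (A i) k × InZ I (n + r j) (k + c i)

module RegularSet {M N : ℕ} {A : Grid} (reg : Regular M N A) where
  open Regular reg

  blocked⇔countInZ : ∀ {I r c i j} → Blocked I r c A i j ⇔ CountInZ I r c A i j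
  blocked⇔countInZ {i = i} {j} = mk⇔
    (λ (n , k , rowSeg , colSeg , z) → n , k , segment⇒counts rowSeg , segment⇒counts colSeg , z)
    (λ (n , k , rowCount , colCount , z) →
      n , k , counts⇒segment (λ x → dec x j) (row-down j) rowCount
            , counts⇒segment (dec i) (col-down i) colCount , z)

  blocked-at : ∀ {I r c i j n k} → IsSegment (λ x → A x j) n → IsSegment (A i) k →
               Blocked I r c A i j ⇔ InZ I (n + r j) (k + c i)
  blocked-at {I} {r} {c} {i} {j} rowSeg colSeg = mk⇔
    (λ (_ , _ , rowSeg′ , colSeg′ , z) →
      subst₂ (λ n k → InZ I (n + r j) (k + c i)) (segment-unique rowSeg′ rowSeg) (segment-unique colSeg′ colSeg) z)
    (λ z → _ , _ , rowSeg , colSeg , z)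

  -- A line through a point of column M (row N) is infinite and never blocks; otherwise the
  -- lines are segments and blocked-at applies.
  blocked? : ∀ I r c i j → Dec (Blocked I r c A i j)
  blocked? I r c i j with dec M j | dec i N
  ... | yes AMj | _ = no λ (_ , _ , rowSeg , _) →
    cofinite⇒¬segment M (λ _ M≤x → cols-stable j M≤x AMj) rowSeg
  ... | no _ | yes AiN = no λ (_ , _ , _ , colSeg , _) →
    cofinite⇒¬segment N (λ _ N≤y → rows-stable i N≤y AiN) colSeg
  ... | no ¬AMj | no ¬AiN =
    let _ , _ , rowSeg = segment-below (λ x → dec x j) (row-down j) M ¬AMj
        _ , _ , colSeg = segment-below (dec i) (col-down i) N ¬AiN
    in map-dec (⇔-sym (blocked-at {I} {r} {c} rowSeg colSeg)) (inZ? I _ _)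

  countInZ? : ∀ I r c i j → Dec (CountInZ I r c A i j)
  countInZ? I r c i j = map-dec (blocked⇔countInZ {I} {r} {c}) (blocked? I r c i j)

  blocked-transfer : ∀ {B I r c r′ c′ i j i′ j′} →
    (∀ x → A x j′ → B x j) → (∀ y → A i′ y → B i y) → r′ j′ ≤ r j → c′ i′ ≤ c i →
    Blocked I r c B i j → Blocked I r′ c′ A i′ j′
  blocked-transfer {I = I} {i′ = i′} {j′} rows cols r′≤r c′≤c (n , k , rowSeg , colSeg , z) =
    let n′ , n′≤n , rowSeg′ = sub-segment (λ x → dec x j′) (row-down j′) rows rowSeg
        k′ , k′≤k , colSeg′ = sub-segment (dec i′) (col-down i′) cols colSeg
    in n′ , k′ , rowSeg′ , colSeg′ , inZ-down I (+-mono-≤ n′≤n r′≤r) (+-mono-≤ k′≤k c′≤c) z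

ten-transfer : ∀ {M N M′ N′ A B I r c r′ c′ i j i′ j′} → Regular M N A → Regular M′ N′ B →
  (A i′ j′ → B i j) → (∀ x → A x j′ → B x j) → (∀ y → A i′ y → B i y) → r′ j′ ≤ r j → c′ i′ ≤ c i →
  Ten I r′ c′ A i′ j′ → Ten I r c B i j
ten-transfer _ _ old _ _ _ _ (inj₁ a) = inj₁ (old a)
ten-transfer {B = B} {I} {r} {c} {r′} {c′} regA regB _ rows cols r′≤r c′≤c (inj₂ ¬blocked) =
  inj₂ (¬blocked ∘ to (RegularSet.blocked⇔countInZ regA {I} {r′} {c′})
                 ∘ RegularSet.blocked-transfer regA {B} {I} {r} {c} {r′} {c′} rows cols r′≤r c′≤c
                 ∘ from (RegularSet.blocked⇔countInZ regB {I} {r} {c}))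

-- T_en preserves regularity: each defining property is an instance of ten-transfer
-- (points move down or out along lines while their lines only shrink).
ten-regular : ∀ {M N A I r c} → EnhancementBelow N r → EnhancementBelow M c →
              Regular M N A → Regular M N (Ten I r c A)
ten-regular {M} {N} {A} {I} {r} {c} r↓ c↓ reg = record
  { dec = λ i j → dec i j ⊎-dec ¬? (countInZ? I r c i j)
  ; row-down = λ j b≤a → move (row-down j b≤a)
      (λ _ → id) (λ y → row-down y b≤a) ≤-refl (antitone (decreasing c↓) b≤a)
  ; col-down = λ i b≤a → move (col-down i b≤a)
      (λ x → col-down x b≤a) (λ _ → id) (antitone (decreasing r↓) b≤a) ≤-refl
  ; cols-stable = λ j M≤i → move (cols-stable j M≤i)
      (λ _ → id) (λ y → cols-stable y M≤i) ≤-refl (vanishing c↓)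
  ; rows-stable = λ i N≤j → move (rows-stable i N≤j)
      (λ x → rows-stable x N≤j) (λ _ → id) (vanishing r↓) ≤-refl
  }
  where
  open Regular reg
  open RegularSet reg
  move : ∀ {i j i′ j′} → (A i′ j′ → A i j) → (∀ x → A x j′ → A x j) → (∀ y → A i′ y → A i y) →
         r j′ ≤ r j → c i′ ≤ c i → Ten I r c A i′ j′ → Ten I r c A i j
  move old rows cols r≤ c≤ =
    ten-transfer {A = A} {A} {I} {r} {c} {r} {c} reg reg old rows cols r≤ c≤
  vanishing : ∀ {K s} → EnhancementBelow K s → ∀ {n} → s K ≤ s n
  vanishing s↓ = ≤-trans (≤-reflexive (vanishes s↓)) z≤n

empty-regular : ∀ {M N} → Regular M N (λ _ _ → ⊥)
empty-regular = record
  { dec = λ _ _ → no λ () ; row-down = λ _ _ () ; col-down = λ _ _ ()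
  ; cols-stable = λ _ _ () ; rows-stable = λ _ _ () }

iter-regular : ∀ {M N I r c} → EnhancementBelow N r → EnhancementBelow M c →
               ∀ t → Regular M N (TenIter I r c t)
iter-regular r↓ c↓ zero = empty-regular
iter-regular r↓ c↓ (suc t) = ten-regular r↓ c↓ (iter-regular r↓ c↓ t)

ten-mono : ∀ {M N M′ N′ A B I r c ρ γ} → Regular M N A → Regular M′ N′ B → A ⊆² B →
           (∀ j → ρ j ≤ r j) → (∀ i → γ i ≤ c i) → Ten I ρ γ A ⊆² Ten I r c B
ten-mono {A = A} {B} {I} {r} {c} {ρ} {γ} regA regB A⊆B ρ≤r γ≤c i j =
  ten-transfer {A = A} {B} {I} {r} {c} {ρ} {γ} regA regB (A⊆B i j) (λ x → A⊆B x j) (A⊆B i) (ρ≤r j) (γ≤c i)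

iter-mono : ∀ {M N I r c ρ γ} → EnhancementBelow N ρ → EnhancementBelow M γ →
            EnhancementBelow N r → EnhancementBelow M c →
            (∀ j → ρ j ≤ r j) → (∀ i → γ i ≤ c i) → ∀ t → TenIter I ρ γ t ⊆² TenIter I r c t
iter-mono ρ↓ γ↓ r↓ c↓ ρ≤r γ≤c zero i j ()
iter-mono ρ↓ γ↓ r↓ c↓ ρ≤r γ≤c (suc t) =
  ten-mono (iter-regular ρ↓ γ↓ t) (iter-regular r↓ c↓ t) (iter-mono ρ↓ γ↓ r↓ c↓ ρ≤r γ≤c t) ρ≤r γ≤c

iter-increasing : ∀ {M N I r c} → EnhancementBelow N r → EnhancementBelow M c →
                  ∀ t → TenIter I r c t ⊆² TenIter I r c (suc t)
iter-increasing r↓ c↓ zero i j ()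
iter-increasing r↓ c↓ (suc t) =
  ten-mono (iter-regular r↓ c↓ t) (iter-regular r↓ c↓ (suc t)) (iter-increasing r↓ c↓ t)
           (λ _ → ≤-refl) (λ _ → ≤-refl)

iter-⊆-closed : ∀ {M N M′ N′ I r c S} → EnhancementBelow N r → EnhancementBelow M c →
                Regular M′ N′ S → Ten I r c S ⊆² S → ∀ t → TenIter I r c t ⊆² S
iter-⊆-closed r↓ c↓ reg closed zero i j ()
iter-⊆-closed {I = I} {r} {c} r↓ c↓ reg closed (suc t) i j p =
  closed i j (ten-mono {I = I} {r} {c} {r} {c} (iter-regular r↓ c↓ t) reg (iter-⊆-closed r↓ c↓ reg closed t)
                       (λ _ → ≤-refl) (λ _ → ≤-refl) i j p)

𝟙 : {P : Set} → Dec P → ℕ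
𝟙 (yes _) = 1
𝟙 (no _) = 0

𝟙-mono : {P Q : Set} (P? : Dec P) (Q? : Dec Q) → (P → Q) → 𝟙 P? ≤ 𝟙 Q?
𝟙-mono (yes _) (yes _) _ = ≤-refl
𝟙-mono (yes p) (no ¬q) P⇒Q = ⊥-elim (¬q (P⇒Q p))
𝟙-mono (no _) _ _ = z≤n

𝟙-reflect : {P Q : Set} (P? : Dec P) (Q? : Dec Q) → 𝟙 Q? ≡ 𝟙 P? → Q → P
𝟙-reflect (yes p) _ _ _ = p
𝟙-reflect (no _) (yes _) () _
𝟙-reflect (no _) (no ¬q) _ q = ⊥-elim (¬q q)

sumTo : (ℕ → ℕ) → ℕ → ℕ
sumTo f zero = 0
sumTo f (suc k) = f k + sumTo f k

sumTo-mono : ∀ f g k → (∀ i → i < k → f i ≤ g i) → sumTo f k ≤ sumTo g k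
sumTo-mono f g zero f≤g = z≤n
sumTo-mono f g (suc k) f≤g = +-mono-≤ (f≤g k ≤-refl) (sumTo-mono f g k (λ i i<k → f≤g i (m≤n⇒m≤1+n i<k)))

+-rigid : ∀ {a b c d} → a ≤ b → c ≤ d → b + d ≡ a + c → b ≡ a × d ≡ c
+-rigid {a} {c = c} {d} a≤b c≤d b+d≡a+c with m≤n⇒m<n∨m≡n a≤b
... | inj₁ a<b = ⊥-elim (<-irrefl (sym b+d≡a+c) (+-mono-<-≤ a<b c≤d))
... | inj₂ refl = refl , +-cancelˡ-≡ a d c b+d≡a+c

sumTo-rigid : ∀ f g k → (∀ i → i < k → f i ≤ g i) → sumTo g k ≡ sumTo f k → ∀ i → i < k → g i ≡ f i
sumTo-rigid f g (suc k) f≤g same i i<1+k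
  with +-rigid (f≤g k ≤-refl) (sumTo-mono f g k (λ i i<k → f≤g i (m≤n⇒m≤1+n i<k))) same
     | m≤n⇒m<n∨m≡n (≤-pred i<1+k)
... | last , _ | inj₂ refl = last
... | _ , rest | inj₁ i<k = sumTo-rigid f g k (λ i i<k → f≤g i (m≤n⇒m≤1+n i<k)) rest i i<k

boxCount : ∀ M N {A : Grid} → (∀ i j → Dec (A i j)) → ℕ
boxCount M N A? = sumTo (λ j → sumTo (λ i → 𝟙 (A? i j)) (suc M)) (suc N)

boxCount-mono : ∀ M N {A B : Grid} (A? : ∀ i j → Dec (A i j)) (B? : ∀ i j → Dec (B i j)) →
                A ⊆² B → boxCount M N A? ≤ boxCount M N B?
boxCount-mono M N A? B? A⊆B =
  sumTo-mono _ _ (suc N) λ j _ → sumTo-mono _ _ (suc M) λ i _ → 𝟙-mono (A? i j) (B? i j) (A⊆B i j)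

boxCount-rigid : ∀ M N {A B : Grid} (A? : ∀ i j → Dec (A i j)) (B? : ∀ i j → Dec (B i j)) →
                 A ⊆² B → boxCount M N B? ≡ boxCount M N A? →
                 ∀ i j → i ≤ M → j ≤ N → B i j → A i j
boxCount-rigid M N A? B? A⊆B same i j i≤M j≤N =
  𝟙-reflect (A? i j) (B? i j)
    (sumTo-rigid _ _ (suc M) (λ i _ → 𝟙-mono (A? i j) (B? i j) (A⊆B i j))
      (sumTo-rigid _ _ (suc N) (λ j _ → sumTo-mono _ _ (suc M) λ i _ → 𝟙-mono (A? i j) (B? i j) (A⊆B i j))
        same j (s≤s j≤N))
      i (s≤s i≤M))

module Clamp {M N : ℕ} {A : Grid} (reg : Regular M N A) where
  open Regular reg

  clamp : ∀ {i j} → A i j → A (i ⊓ M) (j ⊓ N)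
  clamp {i} {j} = col-down (i ⊓ M) (m⊓n≤m j N) ∘ row-down j (m⊓n≤m i M)

  unclamp : ∀ {i j} → A (i ⊓ M) (j ⊓ N) → A i j
  unclamp {i} {j} = unclamp-col ∘ unclamp-row
    where
    unclamp-row : A (i ⊓ M) (j ⊓ N) → A (i ⊓ M) j
    unclamp-row with ≤-total j N
    ... | inj₁ j≤N = subst (A (i ⊓ M)) (m≤n⇒m⊓n≡m j≤N)
    ... | inj₂ N≤j = rows-stable (i ⊓ M) N≤j ∘ subst (A (i ⊓ M)) (m≥n⇒m⊓n≡n N≤j)
    unclamp-col : A (i ⊓ M) j → A i j
    unclamp-col with ≤-total i M
    ... | inj₁ i≤M = subst (λ x → A x j) (m≤n⇒m⊓n≡m i≤M)
    ... | inj₂ M≤i = cols-stable j M≤i ∘ subst (λ x → A x j) (m≥n⇒m⊓n≡n M≤i)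

box-determines : ∀ {M N A B} → Regular M N A → Regular M N B →
                 (∀ i j → i ≤ M → j ≤ N → B i j → A i j) → B ⊆² A
box-determines {M} {N} regA regB B⊆A-on-box i j =
  Clamp.unclamp regA ∘ B⊆A-on-box _ _ (m⊓n≤n i M) (m⊓n≤n j N) ∘ Clamp.clamp regB

plateau-or-growth : (f : ℕ → ℕ) → (∀ t → f t ≤ f (suc t)) → ∀ k → (∃[ t ] f (suc t) ≡ f t) ⊎ (k ≤ f k)
plateau-or-growth f increasing zero = inj₂ z≤n
plateau-or-growth f increasing (suc k) with plateau-or-growth f increasing k
... | inj₁ flat = inj₁ flat
... | inj₂ k≤fk with f (suc k) ≟ f k
...   | yes flat = inj₁ (k , flat)
...   | no rises = inj₂ (≤-<-trans k≤fk (≤∧≢⇒< (increasing k) (rises ∘ sym)))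

plateau : (f : ℕ → ℕ) → (∀ t → f t ≤ f (suc t)) → ∀ B → (∀ t → f t ≤ B) → ∃[ t ] f (suc t) ≡ f t
plateau f increasing B bounded with plateau-or-growth f increasing (suc B)
... | inj₁ flat = flat
... | inj₂ 1+B≤f = ⊥-elim (n≮n B (≤-trans 1+B≤f (bounded (suc B))))

-- An increasing chain of regular sets with common M and N becomes stationary: the box counts
-- increase and are bounded by the size of the box, and at a plateau the box determines the set.
stabilises : ∀ {M N} (F : ℕ → Grid) → (∀ t → Regular M N (F t)) → (∀ t → F t ⊆² F (suc t)) →
             ∃[ t ] F (suc t) ⊆² F t
stabilises {M} {N} F reg grows =
  let t , same = plateau count (λ t → boxCount-mono M N (F? t) (F? (suc t)) (grows t))
                   (boxCount M N full?) (λ t → boxCount-mono M N (F? t) full? λ _ _ _ → tt)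
  in t , box-determines (reg t) (reg (suc t)) (boxCount-rigid M N (F? t) (F? (suc t)) (grows t) same)
  where
  F? : ∀ t i j → Dec (F t i j)
  F? t = Regular.dec (reg t)
  full? : ∀ i j → Dec ⊤
  full? _ _ = yes tt
  count : ℕ → ℕ
  count t = boxCount M N (F? t)

module TruncatedFixedPoint {M N I r c ρ γ S} (er : Enhancement r) (ec : Enhancement c)
         (trunc : Truncation I r c ρ γ) (reg : Regular M N S) (fixed : Ten I ρ γ S ⊆² S) where
  open Regular reg
  open RegularSet reg

  -- Outside S every point is blocked for (ρ, γ), since otherwise T_en would add it.
  blocked-for-truncation : ∀ {i j} → ¬ S i j → Blocked I ρ γ S i j
  blocked-for-truncation {i} {j} ¬S with blocked? I ρ γ i j
  ... | yes blocked = blocked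
  ... | no ¬blocked = ⊥-elim (¬S (fixed i j (inj₂ (¬blocked ∘ from (blocked⇔countInZ {I} {ρ} {γ})))))

  -- Outside S every point is blocked for (r, c) too, by induction on i + j (s bounds it).
  -- If ρ_j < r_j, Z has room only below row y = k + γ_i < j, where k is the height of column
  -- i of S; (i, y) is outside S, blocked for (r, c) by induction, and its row contains row j,
  -- which blocks (i, j).  The case γ_i < c_i is symmetric, and otherwise (ρ, γ) = (r, c) at (i, j).
  blocked-outside : ∀ s {i j} → i + j < s → ¬ S i j → Blocked I r c S i j
  blocked-outside (suc s) {i} {j} i+j<1+s ¬S
    with blocked-for-truncation ¬S | ρ j <? r j | γ i <? c i
  ... | n , k , _ , colSeg , z | yes ρ<r | _ =
    blocked-transfer {S} {I} {r} {c} {r} {c}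
      (λ x → col-down x (<⇒≤ y<j)) (λ _ → id) (antitone er (<⇒≤ y<j)) ≤-refl
      (blocked-outside s (<-≤-trans (+-monoʳ-< i y<j) (≤-pred i+j<1+s)) ¬Siy)
    where
    y<j : k + γ i < j
    y<j = row-cut trunc ρ<r (m≤n+m (ρ j) n) z
    ¬Siy : ¬ S i (k + γ i)
    ¬Siy Siy = <⇒≱ (to (colSeg _) Siy) (m≤m+n k (γ i))
  ... | n , k , rowSeg , _ , z | no _ | yes γ<c =
    blocked-transfer {S} {I} {r} {c} {r} {c}
      (λ _ → id) (λ y → row-down y (<⇒≤ x<i)) ≤-refl (antitone ec (<⇒≤ x<i))
      (blocked-outside s (<-≤-trans (+-monoˡ-< j x<i) (≤-pred i+j<1+s)) ¬Sxj)
    where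
    x<i : n + ρ j < i
    x<i = col-cut trunc γ<c (m≤n+m (γ i) k) z
    ¬Sxj : ¬ S (n + ρ j) j
    ¬Sxj Sxj = <⇒≱ (to (rowSeg _) Sxj) (m≤m+n n (ρ j))
  ... | n , k , rowSeg , colSeg , z | no ¬ρ<r | no ¬γ<c =
    n , k , rowSeg , colSeg , inZ-down I (+-monoʳ-≤ n (≮⇒≥ ¬ρ<r)) (+-monoʳ-≤ k (≮⇒≥ ¬γ<c)) z

  closed : Ten I r c S ⊆² S
  closed i j (inj₁ Sij) = Sij
  closed i j (inj₂ ¬blocked) with dec i j
  ... | yes Sij = Sij
  ... | no ¬Sij = ⊥-elim (¬blocked (to (blocked⇔countInZ {I} {r} {c}) (blocked-outside _ ≤-refl ¬Sij)))

-- A truncation of a spanning pair spans: its dynamics stabilises at a set S, which is closed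
-- under the original dynamics and therefore contains every point.
truncation-spans : ∀ {M N I r c ρ γ} → EnhancementBelow N r → EnhancementBelow M c →
                   EnhancementBelow N ρ → EnhancementBelow M γ → Truncation I r c ρ γ →
                   Spans I r c → Spans I ρ γ
truncation-spans {I = I} {r} {c} {ρ} {γ} r↓ c↓ ρ↓ γ↓ trunc spans i j =
  t₀ , iter-⊆-closed r↓ c↓ (iter-regular ρ↓ γ↓ t₀) closed (proj₁ (spans i j)) i j (proj₂ (spans i j))
  where
  stable : ∃[ t ] TenIter I ρ γ (suc t) ⊆² TenIter I ρ γ t
  stable = stabilises (TenIter I ρ γ) (iter-regular ρ↓ γ↓) (iter-increasing ρ↓ γ↓)
  t₀ : ℕ
  t₀ = proj₁ stable
  open TruncatedFixedPoint (decreasing r↓) (decreasing c↓) trunc (iter-regular ρ↓ γ↓ t₀) (proj₂ stable)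

finSupp-below : ∀ {r} → Enhancement r → (support : FinSupp r) → EnhancementBelow (proj₁ support) r
finSupp-below er (N , r0) = record { decreasing = er ; vanishes = r0 N ≤-refl }

module Capped (I : List (ℕ × ℕ)) {r c : ℕ → ℕ} (er : Enhancement r) (ec : Enhancement c)
              (r-support : FinSupp r) (c-support : FinSupp c) where
  ρ γ : ℕ → ℕ
  ρ = r ⊓ˢ width I
  γ = c ⊓ˢ height I

  private
    r↓ : EnhancementBelow (proj₁ r-support) r
    r↓ = finSupp-below er r-support
    c↓ : EnhancementBelow (proj₁ c-support) c
    c↓ = finSupp-below ec c-support
    ρ↓ : EnhancementBelow (proj₁ r-support) ρ
    ρ↓ = ⊓ˢ-below r↓ (width-antitone I)
    γ↓ : EnhancementBelow (proj₁ c-support) γ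
    γ↓ = ⊓ˢ-below c↓ (height-antitone I)

  capped-admissible : Spans I r c → AdmissibleTilde I ρ γ
  capped-admissible spans =
    ( decreasing ρ↓ , decreasing γ↓ , ⊓ˢ-finSupp (width I) r-support , ⊓ˢ-finSupp (height I) c-support
    , truncation-spans r↓ c↓ ρ↓ γ↓ (width-truncation I r c) spans )
    , width-truncation-youngR I r , width-truncation-youngC I c

  slower : ∀ t → TenIter I ρ γ t ⊆² TenIter I r c t
  slower = iter-mono ρ↓ γ↓ r↓ c↓ (row≤ (width-truncation I r c)) (col≤ (width-truncation I r c))

lemma5p2 : (I : List (ℕ × ℕ)) → All (λ p → 1 ≤ proj₁ p × 1 ≤ proj₂ p) I →
    (m : ℕ) → IsMuEn I m → IsSupTilde I m
lemma5p2 I _ m ((r , c , (er , ec , r-support , c-support , spans) , τ≡m) , upper) =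
  (λ r′ c′ → upper r′ c′ ∘ proj₁) , below-every-bound
  where
  open Capped I er ec r-support c-support
  -- The capped pair fills the plane within any bound b on Ã_en, and (r, c) is no slower.
  below-every-bound : ∀ b → (∀ r c → AdmissibleTilde I r c → ∃[ t ] (TauIs I r c t × t ≤ b)) → m ≤ b
  below-every-bound b bound =
    let t , (filled , _) , t≤b = bound ρ γ (capped-admissible spans)
    in ≤-trans (proj₂ τ≡m t λ i j → slower t i j (filled i j)) t≤b
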